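{- Let $p$ be a prime and let $D$ be a positive integer with $D \not\equiv 0 \pmod p$. Let $k \ge 1$ and let $A_1,\dots,A_k \subseteq \mathbb{Z}_p$ be (not necessarily distinct) $D$-APs. Then \[ \Big|\sum_{i=1}^k A_i\Big| = \min\Big\{p,\ \sum_{i=1}^k |A_i| - k + 1\Big\}. \]
   Context: $\mathbb{Z}_p=\{0,\dots,p-1\}$ under addition modulo $p$. For sets $A_1,\dots,A_k\subseteq \mathbb{Z}_p$, the sumset is $\sum_{i=1}^k A_i = A_1+\dots+A_k = \{a_1+\dots+a_k \bmod p : a_i\in A_i\}$. For $b\in\{0,\dots,D-1\}$, the $D$-AP in $\mathbb{Z}_p$ with base $b$ is $A_{(b)} = \{b, b+D, b+2D, \dots, b+\lfloor (p-1-b)/D\rfloor D\}\subseteq \mathbb{Z}_p$ (i.e., all $b+iD$ with $i\ge 0$ and $b+iD<p$); a $D$-AP is a set of this form for some such $b$. -}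

module Defs where

open import Data.Nat using (ℕ; zero; suc; _+_; _∸_; _≤ᵇ_; _≡ᵇ_; NonZero)
open import Data.Nat.DivMod using (_%_)
open import Data.Bool using (Bool; true; false; _∧_; _∨_)
open import Data.Fin using (Fin; toℕ)
open import Data.Fin.Subset using (Subset; _∈_)
open import Data.Vec using (Vec; tabulate; lookup)
open import Data.List using (List)
open import Data.Bool.ListAction using (any)
open import Data.List using (allFin)
open import Data.Fin.Subset using (∣_∣)

-- The D-AP in ℤ_p with base b:  { b + i D : i ≥ 0, b + i D < p },
-- as a subset of Fin p (elements of ℤ_p are represented by 0,…,p-1).
-- x belongs iff b ≤ x and D divides x ∸ b.
AP : (p D b : ℕ) → .{{NonZero D}} → Subset p
AP p D b = tabulate λ x → (b ≤ᵇ toℕ x) ∧ (((toℕ x ∸ b) % D) ≡ᵇ 0)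

_⊕_ : {p : ℕ} → .{{NonZero p}} → Subset p → Subset p → Subset p
_⊕_ {p} A B = tabulate λ x →
  any (λ a → any (λ c → lookup A a ∧ lookup B c ∧ (((toℕ a + toℕ c) % p) ≡ᵇ toℕ x))
                 (allFin p))
      (allFin p)

-- Iterated sumset A₁ + … + A_{k} for a nonempty family (k = suc n).
sumset : {p : ℕ} → .{{NonZero p}} → (n : ℕ) → (Fin (suc n) → Subset p) → Subset p
sumset zero    A = A Fin.zero
sumset (suc n) A = A Fin.zero ⊕ sumset n (λ i → A (Fin.suc i))

-- A D-AP A with base b < p is the progression { b + i D mod p : i < L } with L = |A|, and
-- adding two progressions of step D with lengths L and L′ gives the progression of step D
-- with length L + L′ - 1 based at the sum of the bases.  Hence the sumset is a progression of
-- length Σ |Aᵢ| - k + 1.  Since p is prime and p ∤ D, the points c + i D with i < p are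
-- pairwise distinct mod p, so a progression of length L has exactly min(p, L) elements.
module Submission where

open import Defs
open import Data.Bool using (Bool; T)
open import Data.Bool.Properties using (T-≡; T-∧)
open import Data.Fin using (Fin; toℕ; zero; suc)
open import Data.Fin.Properties using (toℕ-fromℕ<; toℕ-injective; toℕ<n)
open import Data.Fin.Subset using (Subset; _⊆_; _∈_; _∉_; _∪_; ⁅_⁆; ⊥; ∣_∣; inside; outside)
open import Data.Fin.Subset.Properties using (∪-identityʳ; ⊆-antisym; x∈p∪q⁺; x∈p∪q⁻; x∈⁅x⁆; x∈⁅y⁆⇒x≡y; ∉⊥; ∣⊥∣≡0; ∣p∣≤n; p⊆q⇒∣p∣≤∣q∣; p⊆p∪q)
open import Data.List using ([]; _∷_; map; allFin; length)
open import Data.List.Properties using (map-tabulate; length-tabulate; map-cong)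
open import Data.List.Relation.Unary.Any.Properties using (any⁺; any⁻; tabulate⁺; tabulate⁻)
open import Data.Nat using (ℕ; zero; suc; s≤s; s≤s⁻¹; _+_; _*_; _∸_; _<_; _≤_; _⊓_; NonZero; >-nonZero)
open import Data.Nat.Properties
open import Data.Nat.DivMod
open import Data.Nat.Divisibility using (_∣_; divides; ∣m+n∣m⇒∣n; ∣⇒≤)
open import Data.Nat.Primality using (Prime; euclidsLemma)
open import Data.Nat.ListAction using (sum)
open import Data.Product using (_×_; _,_; ∃₂; ∃-syntax)
open import Data.Sum using (inj₁; inj₂; [_,_]′)
open import Data.Nat.Tactic.RingSolver using (solve-∀)
open import Data.Vec using (_∷_; lookup; tabulate; here; there)
open import Data.Vec.Properties using (lookup∘tabulate; []=⇒lookup; lookup⇒[]=)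
open import Function using (_∘_; id; Equivalence)
open import Relation.Binary.PropositionalEquality
open import Relation.Nullary using (¬_; yes; no; contradiction)
open import Algebra.Properties.CommutativeSemigroup +-commutativeSemigroup using (x∙yz≈y∙xz)

open Equivalence using (to; from)

∈⇒T-lookup : ∀ {n} {x : Fin n} {S : Subset n} → x ∈ S → T (lookup S x)
∈⇒T-lookup x∈S = from T-≡ ([]=⇒lookup x∈S)

T-lookup⇒∈ : ∀ {n} {x : Fin n} {S : Subset n} → T (lookup S x) → x ∈ S
T-lookup⇒∈ {x = x} {S} t = lookup⇒[]= x S (to T-≡ t)

∈-tabulate⁻ : ∀ {n} {f : Fin n → Bool} {x} → x ∈ tabulate f → T (f x)
∈-tabulate⁻ {f = f} {x} x∈ = subst T (lookup∘tabulate f x) (∈⇒T-lookup x∈)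

∈-tabulate⁺ : ∀ {n} {f : Fin n → Bool} {x} → T (f x) → x ∈ tabulate f
∈-tabulate⁺ {f = f} {x} t = T-lookup⇒∈ (subst T (sym (lookup∘tabulate f x)) t)

∣p∪⁅x⁆∣≡1+∣p∣ : ∀ {n} (p : Subset n) (x : Fin n) → x ∉ p → ∣ p ∪ ⁅ x ⁆ ∣ ≡ suc ∣ p ∣
∣p∪⁅x⁆∣≡1+∣p∣ (outside ∷ p) zero    _   = cong (suc ∘ ∣_∣) (∪-identityʳ p)
∣p∪⁅x⁆∣≡1+∣p∣ (inside ∷ p)  zero    x∉p = contradiction here x∉p
∣p∪⁅x⁆∣≡1+∣p∣ (outside ∷ p) (suc x) x∉p = ∣p∪⁅x⁆∣≡1+∣p∣ p x (x∉p ∘ there)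
∣p∪⁅x⁆∣≡1+∣p∣ (inside ∷ p)  (suc x) x∉p = cong suc (∣p∪⁅x⁆∣≡1+∣p∣ p x (x∉p ∘ there))

module _ {p : ℕ} .{{_ : NonZero p}} {x : Fin p} where

  ∈-⊕⁻ : ∀ A B → x ∈ A ⊕ B → ∃₂ λ a a′ → a ∈ A × a′ ∈ B × (toℕ a + toℕ a′) % p ≡ toℕ x
  ∈-⊕⁻ A B x∈ with tabulate⁻ (any⁻ _ _ (∈-tabulate⁻ x∈))
  ... | a , any-a′ with tabulate⁻ (any⁻ _ _ any-a′)
  ... | a′ , a∧a′∧sum with to T-∧ a∧a′∧sum
  ... | a∈A , a′∧sum with to T-∧ a′∧sum
  ... | a′∈B , sum≡x = a , a′ , T-lookup⇒∈ a∈A , T-lookup⇒∈ a′∈B , ≡ᵇ⇒≡ _ _ sum≡x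

  ∈-⊕⁺ : ∀ {A B a a′} → a ∈ A → a′ ∈ B → (toℕ a + toℕ a′) % p ≡ toℕ x → x ∈ A ⊕ B
  ∈-⊕⁺ {a = a} {a′} a∈A a′∈B sum≡x = ∈-tabulate⁺ (any⁺ _ (tabulate⁺ a (any⁺ _ (tabulate⁺ a′
    (from T-∧ (∈⇒T-lookup a∈A , from T-∧ (∈⇒T-lookup a′∈B , ≡⇒≡ᵇ _ _ sum≡x)))))))

n∣m∸m%n : ∀ m n .{{_ : NonZero n}} → n ∣ m ∸ m % n
n∣m∸m%n m n = divides (m / n) (begin
  m ∸ m % n             ≡⟨ cong (m ∸_) (m%n≡m∸m/n*n m n) ⟩
  m ∸ (m ∸ m / n * n)   ≡⟨ m∸[m∸n]≡n (m/n*n≤m m n) ⟩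
  m / n * n             ∎)
  where open ≡-Reasoning

[m+k]%n≡m%n⇒n∣k : ∀ m k n .{{_ : NonZero n}} → (m + k) % n ≡ m % n → n ∣ k
[m+k]%n≡m%n⇒n∣k m k n e = ∣m+n∣m⇒∣n (subst (n ∣_) shift (n∣m∸m%n (m + k) n)) (n∣m∸m%n m n)
  where
  shift : m + k ∸ (m + k) % n ≡ m ∸ m % n + k
  shift = trans (cong (m + k ∸_) e) (+-∸-comm k (m%n≤m m n))

≤-+⇒split : ∀ {k} m {n} → k ≤ m + n → ∃₂ λ i j → i ≤ m × j ≤ n × i + j ≡ k
≤-+⇒split {k} m k≤m+n = m ⊓ k , k ∸ m , m⊓n≤m m k , m≤n+o⇒m∸n≤o k m k≤m+n , m⊓n+n∸m≡n m k

sum-map-suc : ∀ {A : Set} (f : A → ℕ) xs → sum (map (suc ∘ f) xs) ≡ length xs + sum (map f xs)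
sum-map-suc f []       = refl
sum-map-suc f (x ∷ xs) = cong suc (trans (cong (f x +_) (sum-map-suc f xs))
                                         (x∙yz≈y∙xz (f x) (length xs) (sum (map f xs))))

sum-allFin-suc : ∀ n (f : Fin (suc n) → ℕ) →
                 sum (map f (allFin (suc n))) ≡ f zero + sum (map (f ∘ suc) (allFin n))
sum-allFin-suc n f =
  cong (λ xs → f zero + sum xs) (trans (map-tabulate suc f) (sym (map-tabulate id (f ∘ suc))))

sum-map-suc-allFin : ∀ n (f : Fin (suc n) → ℕ) →
                     sum (map (suc ∘ f) (allFin (suc n))) ∸ n ≡ suc (sum (map f (allFin (suc n))))
sum-map-suc-allFin n f = begin
  sum (map (suc ∘ f) (allFin (suc n))) ∸ n               ≡⟨ cong (_∸ n) (sum-map-suc f (allFin (suc n))) ⟩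
  length (allFin (suc n)) + sum (map f (allFin (suc n))) ∸ n
    ≡⟨ cong (λ m → m + sum (map f (allFin (suc n))) ∸ n) (length-tabulate {n = suc n} id) ⟩
  suc n + sum (map f (allFin (suc n))) ∸ n               ≡⟨ cong (_∸ n) (sym (+-suc n _)) ⟩
  n + suc (sum (map f (allFin (suc n)))) ∸ n             ≡⟨ m+n∸m≡n n _ ⟩
  suc (sum (map f (allFin (suc n))))                     ∎
  where open ≡-Reasoning

≤∸1⇒< : ∀ {m n} .{{_ : NonZero n}} → m ≤ n ∸ 1 → m < n
≤∸1⇒< {m} {n} m≤n∸1 = m≤pred[n]⇒suc[m]≤n (subst (m ≤_) (sym (pred[m∸n]≡m∸[1+n] n 0)) m≤n∸1)

<⇒≤∸1 : ∀ {m n} → m < n → m ≤ n ∸ 1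
<⇒≤∸1 {m} {n} m<n = subst (m ≤_) (pred[m∸n]≡m∸[1+n] n 0) (suc[m]≤n⇒m≤pred[n] m<n)

module Progressions (p D : ℕ) .{{_ : NonZero p}} .{{_ : NonZero D}} where

  point : ℕ → ℕ → Fin p
  point c i = (c + i * D) mod p

  toℕ-point : ∀ c i → toℕ (point c i) ≡ (c + i * D) % p
  toℕ-point c i = toℕ-fromℕ< (m%n<n (c + i * D) p)

  progression : ℕ → ℕ → Subset p
  progression c zero    = ⊥
  progression c (suc L) = progression c L ∪ ⁅ point c L ⁆

  ∈-progression⁺ : ∀ {c i L} → i < L → point c i ∈ progression c L
  ∈-progression⁺ {c} {i} {suc L} i<1+L with m<1+n⇒m<n∨m≡n i<1+L
  ... | inj₁ i<L  = x∈p∪q⁺ (inj₁ (∈-progression⁺ i<L))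
  ... | inj₂ refl = x∈p∪q⁺ (inj₂ (x∈⁅x⁆ (point c i)))

  ∈-progression⁻ : ∀ c L {x} → x ∈ progression c L → ∃[ i ] i < L × point c i ≡ x
  ∈-progression⁻ c zero    x∈ = contradiction x∈ ∉⊥
  ∈-progression⁻ c (suc L) x∈ with x∈p∪q⁻ (progression c L) ⁅ point c L ⁆ x∈
  ... | inj₁ x∈′ = let i , i<L , e = ∈-progression⁻ c L x∈′ in i , m<n⇒m<1+n i<L , e
  ... | inj₂ x∈⁅⁆ = L , ≤-refl , sym (x∈⁅y⁆⇒x≡y _ x∈⁅⁆)

  toℕ-point-+ : ∀ c c′ i j →
                (toℕ (point c i) + toℕ (point c′ j)) % p ≡ toℕ (point (c + c′) (i + j))
  toℕ-point-+ c c′ i j = begin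
    (toℕ (point c i) + toℕ (point c′ j)) % p
      ≡⟨ cong₂ (λ u v → (u + v) % p) (toℕ-point c i) (toℕ-point c′ j) ⟩
    ((c + i * D) % p + (c′ + j * D) % p) % p  ≡⟨ sym (%-distribˡ-+ (c + i * D) (c′ + j * D) p) ⟩
    (c + i * D + (c′ + j * D)) % p            ≡⟨ cong (_% p) (regroup c c′ i j D) ⟩
    (c + c′ + (i + j) * D) % p                ≡⟨ sym (toℕ-point (c + c′) (i + j)) ⟩
    toℕ (point (c + c′) (i + j))              ∎
    where
    open ≡-Reasoning
    regroup : ∀ c c′ i j D → c + i * D + (c′ + j * D) ≡ c + c′ + (i + j) * D
    regroup = solve-∀

  progression-⊕ : ∀ c c′ L L′ →
                  progression c (suc L) ⊕ progression c′ (suc L′) ≡ progression (c + c′) (suc (L + L′))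
  progression-⊕ c c′ L L′ = ⊆-antisym ⊕⊆ ⊇⊕
    where
    ⊕⊆ : progression c (suc L) ⊕ progression c′ (suc L′) ⊆ progression (c + c′) (suc (L + L′))
    ⊕⊆ x∈ with ∈-⊕⁻ (progression c (suc L)) (progression c′ (suc L′)) x∈
    ... | a , a′ , a∈ , a′∈ , e with ∈-progression⁻ c (suc L) a∈ | ∈-progression⁻ c′ (suc L′) a′∈
    ... | i , i≤L , pᵢ≡a | j , j≤L′ , pⱼ≡a′ =
      subst (_∈ progression (c + c′) (suc (L + L′)))
            (toℕ-injective (trans (sym (toℕ-point-+ c c′ i j))
              (trans (cong₂ (λ u v → (toℕ u + toℕ v) % p) pᵢ≡a pⱼ≡a′) e)))
            (∈-progression⁺ (s≤s (+-mono-≤ (s≤s⁻¹ i≤L) (s≤s⁻¹ j≤L′))))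
    ⊇⊕ : progression (c + c′) (suc (L + L′)) ⊆ progression c (suc L) ⊕ progression c′ (suc L′)
    ⊇⊕ x∈ with ∈-progression⁻ (c + c′) (suc (L + L′)) x∈
    ... | k , k≤L+L′ , pₖ≡x with ≤-+⇒split L (s≤s⁻¹ k≤L+L′)
    ... | i , j , i≤L , j≤L′ , refl =
      subst (_∈ progression c (suc L) ⊕ progression c′ (suc L′)) pₖ≡x
        (∈-⊕⁺ (∈-progression⁺ (s≤s i≤L)) (∈-progression⁺ (s≤s j≤L′)) (toℕ-point-+ c c′ i j))

  sumset-progression : ∀ n {A : Fin (suc n) → Subset p} (c l : Fin (suc n) → ℕ) →
                       (∀ i → A i ≡ progression (c i) (suc (l i))) →
                       sumset n A ≡ progression (sum (map c (allFin (suc n))))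
                                                (suc (sum (map l (allFin (suc n)))))
  sumset-progression zero    c l A≡ =
    trans (A≡ zero) (cong₂ (λ c₀ l₀ → progression c₀ (suc l₀))
                           (sym (+-identityʳ (c zero))) (sym (+-identityʳ (l zero))))
  sumset-progression (suc n) {A} c l A≡ = begin
    A zero ⊕ sumset n (A ∘ suc)
      ≡⟨ cong₂ _⊕_ (A≡ zero) (sumset-progression n (c ∘ suc) (l ∘ suc) (A≡ ∘ suc)) ⟩
    progression (c zero) (suc (l zero)) ⊕ progression (Σ (c ∘ suc)) (suc (Σ (l ∘ suc)))
      ≡⟨ progression-⊕ (c zero) (Σ (c ∘ suc)) (l zero) (Σ (l ∘ suc)) ⟩
    progression (c zero + Σ (c ∘ suc)) (suc (l zero + Σ (l ∘ suc)))
      ≡⟨ sym (cong₂ (λ c₀ l₀ → progression c₀ (suc l₀))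
                    (sum-allFin-suc (suc n) c) (sum-allFin-suc (suc n) l)) ⟩
    progression (sum (map c (allFin (suc (suc n))))) (suc (sum (map l (allFin (suc (suc n)))))) ∎
    where
    open ≡-Reasoning
    Σ : (Fin (suc n) → ℕ) → ℕ
    Σ f = sum (map f (allFin (suc n)))

  apLength : ℕ → ℕ
  apLength b = (p ∸ 1 ∸ b) / D

  AP≡progression : ∀ {b} → b < p → AP p D b ≡ progression b (suc (apLength b))
  AP≡progression {b} b<p = ⊆-antisym AP⊆ ⊇AP
    where
    AP⊆ : AP p D b ⊆ progression b (suc (apLength b))
    AP⊆ {x} x∈ with to T-∧ (∈-tabulate⁻ x∈)
    ... | b≤ᵇx , D∣ᵇx∸b = subst (_∈ progression b (suc (apLength b))) pᵢ≡x (∈-progression⁺ (s≤s i≤))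
      where
      b≤x : b ≤ toℕ x
      b≤x = ≤ᵇ⇒≤ b (toℕ x) b≤ᵇx
      i : ℕ
      i = (toℕ x ∸ b) / D
      x∸b≡iD : toℕ x ∸ b ≡ i * D
      x∸b≡iD = trans (m≡m%n+[m/n]*n (toℕ x ∸ b) D) (cong (_+ i * D) (≡ᵇ⇒≡ _ 0 D∣ᵇx∸b))
      pᵢ≡x : point b i ≡ x
      pᵢ≡x = toℕ-injective (begin
        toℕ (point b i)       ≡⟨ toℕ-point b i ⟩
        (b + i * D) % p       ≡⟨ cong (λ m → (b + m) % p) (sym x∸b≡iD) ⟩
        (b + (toℕ x ∸ b)) % p ≡⟨ cong (_% p) (m+[n∸m]≡n b≤x) ⟩
        toℕ x % p             ≡⟨ m<n⇒m%n≡m (toℕ<n x) ⟩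
        toℕ x                 ∎)
        where open ≡-Reasoning
      i≤ : i ≤ apLength b
      i≤ = /-monoˡ-≤ D (∸-monoˡ-≤ b (<⇒≤∸1 (toℕ<n x)))
    ⊇AP : progression b (suc (apLength b)) ⊆ AP p D b
    ⊇AP {x} x∈ with ∈-progression⁻ b (suc (apLength b)) x∈
    ... | i , i≤ , pᵢ≡x = subst (_∈ AP p D b) pᵢ≡x (∈-tabulate⁺ (from T-∧
          ( ≤⇒≤ᵇ (subst (b ≤_) (sym toℕpᵢ) (m≤m+n b (i * D)))
          , ≡⇒≡ᵇ _ 0 (trans (cong (λ m → (m ∸ b) % D) toℕpᵢ)
                          (trans (cong (_% D) (m+n∸m≡n b (i * D))) (m*n%n≡0 i D))))))
      where
      b+iD≤p∸1 : b + i * D ≤ p ∸ 1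
      b+iD≤p∸1 = begin
        b + i * D               ≤⟨ +-monoʳ-≤ b (*-monoˡ-≤ D (s≤s⁻¹ i≤)) ⟩
        b + apLength b * D      ≤⟨ +-monoʳ-≤ b (m/n*n≤m (p ∸ 1 ∸ b) D) ⟩
        b + (p ∸ 1 ∸ b)         ≡⟨ m+[n∸m]≡n (<⇒≤∸1 b<p) ⟩
        p ∸ 1                   ∎
        where open ≤-Reasoning
      toℕpᵢ : toℕ (point b i) ≡ b + i * D
      toℕpᵢ = trans (toℕ-point b i) (m<n⇒m%n≡m (≤∸1⇒< b+iD≤p∸1))

  module _ (p-prime : Prime p) (p∤D : ¬ p ∣ D) where

    point-injective : ∀ c {i j} → i < j → j < p → point c i ≢ point c j
    point-injective c {i} {j} i<j j<p pᵢ≡pⱼ = [ p∤d , p∤D ]′ (euclidsLemma d D p-prime p∣dD)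
      where
      d : ℕ
      d = j ∸ i
      p∣dD : p ∣ d * D
      p∣dD = [m+k]%n≡m%n⇒n∣k (c + i * D) (d * D) p (begin
        (c + i * D + d * D) % p  ≡⟨ cong (_% p) (+-assoc c (i * D) (d * D)) ⟩
        (c + (i * D + d * D)) % p ≡⟨ cong (λ m → (c + m) % p) (sym (*-distribʳ-+ D i d)) ⟩
        (c + (i + d) * D) % p   ≡⟨ cong (λ m → (c + m * D) % p) (m+[n∸m]≡n (<⇒≤ i<j)) ⟩
        (c + j * D) % p         ≡⟨ sym (toℕ-point c j) ⟩
        toℕ (point c j)         ≡⟨ cong toℕ (sym pᵢ≡pⱼ) ⟩
        toℕ (point c i)         ≡⟨ toℕ-point c i ⟩
        (c + i * D) % p         ∎)
        where open ≡-Reasoning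
      p∤d : ¬ p ∣ d
      p∤d p∣d = <-irrefl refl
        (≤-<-trans (≤-trans (∣⇒≤ {{>-nonZero (m<n⇒0<n∸m i<j)}} p∣d) (m∸n≤m j i)) j<p)

    point∉progression : ∀ c {L} → L < p → point c L ∉ progression c L
    point∉progression c {L} L<p pₗ∈ =
      let i , i<L , pᵢ≡pₗ = ∈-progression⁻ c L pₗ∈ in point-injective c i<L L<p pᵢ≡pₗ

    ∣progression∣≡p⊓L : ∀ c L → ∣ progression c L ∣ ≡ p ⊓ L
    ∣progression∣≡p⊓L c zero = trans (∣⊥∣≡0 p) (sym (⊓-zeroʳ p))
    ∣progression∣≡p⊓L c (suc L) with L <? p
    ... | yes L<p = begin
      ∣ progression c L ∪ ⁅ point c L ⁆ ∣ ≡⟨ ∣p∪⁅x⁆∣≡1+∣p∣ _ _ (point∉progression c L<p) ⟩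
      suc ∣ progression c L ∣             ≡⟨ cong suc (∣progression∣≡p⊓L c L) ⟩
      suc (p ⊓ L)                         ≡⟨ cong suc (m≥n⇒m⊓n≡n (<⇒≤ L<p)) ⟩
      suc L                               ≡⟨ sym (m≥n⇒m⊓n≡n L<p) ⟩
      p ⊓ suc L                           ∎
      where open ≡-Reasoning
    ... | no L≮p = trans (≤-antisym (∣p∣≤n (progression c (suc L))) p≤∣progression∣)
                         (sym (m≤n⇒m⊓n≡m (m≤n⇒m≤1+n p≤L)))
      where
      p≤L : p ≤ L
      p≤L = ≮⇒≥ L≮p
      p≤∣progression∣ : p ≤ ∣ progression c (suc L) ∣
      p≤∣progression∣ = ≤-trans (≤-reflexive (sym (trans (∣progression∣≡p⊓L c L) (m≤n⇒m⊓n≡m p≤L))))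
                                (p⊆q⇒∣p∣≤∣q∣ (p⊆p∪q {p = progression c L} ⁅ point c L ⁆))

    ∣AP∣≡1+apLength : ∀ {b} → b < p → ∣ AP p D b ∣ ≡ suc (apLength b)
    ∣AP∣≡1+apLength {b} b<p = begin
      ∣ AP p D b ∣                             ≡⟨ cong ∣_∣ (AP≡progression b<p) ⟩
      ∣ progression b (suc (apLength b)) ∣     ≡⟨ ∣progression∣≡p⊓L b _ ⟩
      p ⊓ suc (apLength b)                     ≡⟨ m≥n⇒m⊓n≡n (≤∸1⇒< apLength≤p∸1) ⟩
      suc (apLength b)                         ∎
      where
      open ≡-Reasoning
      apLength≤p∸1 : apLength b ≤ p ∸ 1
      apLength≤p∸1 = ≤-trans (m/n≤m (p ∸ 1 ∸ b) D) (m∸n≤m (p ∸ 1) b)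

lemma6 : (p D : ℕ) → .{{_ : NonZero p}} → .{{_ : NonZero D}} → Prime p → ¬ (p ∣ D) →
         (n : ℕ) → (b : Fin (suc n) → ℕ) → (∀ i → b i < D) → (∀ i → b i < p) →
         ∣ sumset n (λ i → AP p D (b i)) ∣
           ≡ p ⊓ (sum (map (λ i → ∣ AP p D (b i) ∣) (allFin (suc n))) ∸ n)
lemma6 p D p-prime p∤D n b _ b<p = begin
  ∣ sumset n (λ i → AP p D (b i)) ∣
    ≡⟨ cong ∣_∣ (sumset-progression n b l (AP≡progression ∘ b<p)) ⟩
  ∣ progression (sum (map b (allFin (suc n)))) (suc (sum (map l (allFin (suc n))))) ∣
    ≡⟨ ∣progression∣≡p⊓L p-prime p∤D _ _ ⟩
  p ⊓ suc (sum (map l (allFin (suc n))))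
    ≡⟨ cong (p ⊓_) (sym (sum-map-suc-allFin n l)) ⟩
  p ⊓ (sum (map (suc ∘ l) (allFin (suc n))) ∸ n)
    ≡⟨ cong (λ xs → p ⊓ (sum xs ∸ n))
            (sym (map-cong (∣AP∣≡1+apLength p-prime p∤D ∘ b<p) (allFin (suc n)))) ⟩
  p ⊓ (sum (map (λ i → ∣ AP p D (b i) ∣) (allFin (suc n))) ∸ n) ∎
  where
  open ≡-Reasoning
  open Progressions p D
  l : Fin (suc n) → ℕ
  l = apLength ∘ b
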